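{- Let $a,b,c$ be positive integers and $\epsilon_a,\epsilon_b,\epsilon_c\in\{+1,-1\}$. Suppose the signed pattern $[\epsilon_aa,\epsilon_bb,\epsilon_cc]$ satisfies the Basic Parity Test and satisfies the Divisibility condition (i.e. $\gcd(a,c)\mid b$). Then the pattern $[\epsilon_aa,\epsilon_bb,\epsilon_cc]$ satisfies the Parity condition.
   Context: $\nu_2(n)$ denotes the exponent of $2$ in the positive integer $n$. For a signed pattern $[\epsilon_1b_1,\dots,\epsilon_mb_m]$ ($m\ge2$, $b_k$ positive integers, $\epsilon_k\in\{\pm1\}$), let $g=\gcd(b_1,b_m)$ and $I=\sum_{k=2}^{m-1}\epsilon_kb_k$ ($I=0$ if $m=2$). Divisibility condition: $g\mid I$. Parity condition (given Divisibility): $I/g$ is even if and only if the statement "if $\nu_2(b_1)<\nu_2(b_m)$ then $\epsilon_1=-1$; if $\nu_2(b_1)>\nu_2(b_m)$ then $\epsilon_m=+1$; if $\nu_2(b_1)=\nu_2(b_m)$ then $\epsilon_1=-\epsilon_m$" holds. A signed pattern satisfies the Basic Parity Test if each two-element subpattern $[\epsilon_kb_k,\epsilon_{k+1}b_{k+1}]$ of consecutive entries satisfies the Parity condition. -}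

module Defs where

open import Data.Nat using (ℕ; zero; suc; _<_; _>_)
open import Data.Nat.GCD using (gcd)
open import Data.Nat.Divisibility using (_∣?_)
open import Data.Integer as ℤ using (ℤ; +_; _◃_)
open import Data.Integer.Divisibility using () renaming (_∣_ to _∣ℤ_)
open import Data.Sign using (Sign) renaming (+ to ⊕; - to ⊖)
open import Data.List using (List; []; _∷_; foldr)
open import Data.Product using (_×_; _,_)
open import Relation.Binary.PropositionalEquality using (_≡_; _≢_)
open import Relation.Nullary using (yes; no)
open import Function.Bundles using (_⇔_)

-- 2-adic valuation with fuel (fuel = n suffices for n > 0); ν₂ 0 = 0 by convention
ν₂-aux : ℕ → ℕ → ℕ
ν₂-aux zero n = zero
ν₂-aux (suc f) zero = zero
ν₂-aux (suc f) n@(suc m) with 2 ∣? n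
... | yes _ = suc (ν₂-aux f (Data.Nat._/_ n 2))
... | no _ = zero

ν₂ : ℕ → ℕ
ν₂ n = ν₂-aux n n

-- a signed entry ε·b : sign ε and magnitude b (b is required positive separately)
Entry : Set
Entry = Sign × ℕ

sgn : Entry → Sign
sgn (s , _) = s

mag : Entry → ℕ
mag (_ , b) = b

val : Entry → ℤ
val (s , b) = s ◃ b

-- a signed pattern [ε₁b₁, ε₂b₂, …, εₘbₘ] with m ≥ 2, given as
-- first entry, list of interior entries, last entry
record Pattern : Set where
  constructor pat
  field
    first  : Entry
    middle : List Entry
    last   : Entry
open Pattern public

Positive : Pattern → Set
Positive (pat f ms l) = 0 < mag f × foldr (λ e P → 0 < mag e × P) (Data.Unit.⊤) ms × 0 < mag l
  where import Data.Unit

g : Pattern → ℕ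
g p = gcd (mag (first p)) (mag (last p))

I : Pattern → ℤ
I p = foldr (λ e acc → val e ℤ.+ acc) (+ 0) (middle p)

Divisibility : Pattern → Set
Divisibility p = (+ g p) ∣ℤ I p

SignCond : Pattern → Set
SignCond (pat (ε₁ , b₁) _ (εₘ , bₘ)) =
  (ν₂ b₁ < ν₂ bₘ → ε₁ ≡ ⊖) ×
  (ν₂ b₁ > ν₂ bₘ → εₘ ≡ ⊕) ×
  (ν₂ b₁ ≡ ν₂ bₘ → ε₁ ≡ Data.Sign.opposite εₘ)

-- Parity condition (meaningful given Divisibility): I/g is even iff SignCond.
-- Stated via any quotient q with I = q·g (unique since g > 0).
Parity : Pattern → Set
Parity p = ∀ (q : ℤ) → I p ≡ q ℤ.* (+ g p) → ((+ 2) ∣ℤ q ⇔ SignCond p)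

entries : Pattern → List Entry
entries (pat f ms l) = f ∷ Data.List._++_ ms (l ∷ [])

ConsecPairs : List Entry → Set
ConsecPairs [] = Data.Unit.⊤ where import Data.Unit
ConsecPairs (x ∷ []) = Data.Unit.⊤ where import Data.Unit
ConsecPairs (x ∷ y ∷ xs) = Parity (pat x [] y) × ConsecPairs (y ∷ xs)

BasicParityTest : Pattern → Set
BasicParityTest p = ConsecPairs (entries p)

-- Both ν₂ (gcd a c) = min (ν₂ a, ν₂ c) and ν₂ b = ν₂ (q · gcd a c) = ν₂ q + ν₂ (gcd a c),
-- so q is even exactly when min (ν₂ a, ν₂ c) < ν₂ b. The two-entry instances of the Basic
-- Parity Test have I = 0, hence assert the sign conditions for (a, b) and for (b, c); a
-- case analysis on the three signs shows that, given these, min (ν₂ a, ν₂ c) < ν₂ b holds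
-- exactly when the sign condition for (a, c) does.
module Submission where

open import Defs
open import Data.Nat using (ℕ; _<_)
open import Data.Sign using (Sign)
open import Data.List using (_∷_; [])
open import Data.Product using (_,_)

open import Data.Nat.Base
  using (zero; suc; _+_; _∸_; _*_; _^_; _⊓_; _≤_; z≤n; s≤s; NonZero; ≢-nonZero; ≢-nonZero⁻¹; >-nonZero)
open import Data.Nat.Properties
open import Data.Nat.Divisibility
  using (_∣_; _∣?_; divides; ∣-trans; ∣⇒≤; m∣m*n; *-cancelˡ-∣)
open import Data.Nat.DivMod using (_/_; m*[n/m]≡n; m/n<m; m≥n⇒m/n>0)
open import Data.Nat.GCD using (gcd; gcd[m,n]∣m; gcd[m,n]∣n; gcd-greatest; gcd[m,n]≢0)
open import Data.Nat.Primality using (euclidsLemma; prime[2])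
open import Data.Integer.Base as ℤ using (+_; ∣_∣; _◃_)
open import Data.Integer.Properties using (abs-◃; abs-*) renaming (+-identityʳ to ℤ-+-identityʳ)
open import Data.Sign.Base using (opposite) renaming (+ to ⊕; - to ⊖)
open import Data.Product using (∃-syntax; _×_)
open import Data.Sum using (inj₁; inj₂)
open import Data.Unit using (⊤; tt)
open import Relation.Nullary using (¬_; yes; no; contradiction)
open import Relation.Binary.Definitions using (tri<; tri≈; tri>)
open import Relation.Binary.PropositionalEquality
open import Function.Bundles using (_⇔_; mk⇔; Equivalence)
open import Function.Properties.Equivalence using () renaming (trans to ⇔-trans; sym to ⇔-sym)

^-monoʳ-∣ : ∀ m {i j} → i ≤ j → m ^ i ∣ m ^ j
^-monoʳ-∣ m {i} {j} i≤j = divides (m ^ (j ∸ i)) (begin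
  m ^ j               ≡⟨ cong (m ^_) (m+[n∸m]≡n i≤j) ⟨
  m ^ (i + (j ∸ i))   ≡⟨ ^-distribˡ-+-* m i (j ∸ i) ⟩
  m ^ i * m ^ (j ∸ i) ≡⟨ *-comm (m ^ i) _ ⟩
  m ^ (j ∸ i) * m ^ i ∎)
  where open ≡-Reasoning

2^[1+k]∤2^k*odd : ∀ k {o} → ¬ 2 ∣ o → ¬ 2 ^ suc k ∣ 2 ^ k * o
2^[1+k]∤2^k*odd k {o} 2∤o 2^[1+k]∣ =
  2∤o (*-cancelˡ-∣ (2 ^ k) {{m^n≢0 2 k}} (subst (_∣ 2 ^ k * o) (*-comm 2 (2 ^ k)) 2^[1+k]∣))

-- The fuel f only has to exceed the number of halvings, which n ≤ f guarantees.
ν₂-aux-oddPart : ∀ f n .{{_ : NonZero n}} → n ≤ f → ∃[ o ] ¬ 2 ∣ o × n ≡ 2 ^ ν₂-aux f n * o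
ν₂-aux-oddPart zero (suc _) ()
ν₂-aux-oddPart (suc f) n@(suc _) n≤1+f with 2 ∣? n
... | no 2∤n = n , 2∤n , sym (*-identityˡ n)
... | yes 2∣n with ν₂-aux-oddPart f (n / 2) {{>-nonZero (m≥n⇒m/n>0 (∣⇒≤ 2∣n))}}
                     (≤-pred (≤-trans (m/n<m n 2 (s≤s (s≤s z≤n))) n≤1+f))
... | o , 2∤o , n/2≡ = o , 2∤o , (begin
  n                            ≡⟨ m*[n/m]≡n 2∣n ⟨
  2 * (n / 2)                  ≡⟨ cong (2 *_) n/2≡ ⟩
  2 * (2 ^ ν₂-aux f (n / 2) * o) ≡⟨ *-assoc 2 (2 ^ ν₂-aux f (n / 2)) o ⟨
  2 ^ suc (ν₂-aux f (n / 2)) * o ∎)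
  where open ≡-Reasoning

ν₂-oddPart : ∀ n .{{_ : NonZero n}} → ∃[ o ] ¬ 2 ∣ o × n ≡ 2 ^ ν₂ n * o
ν₂-oddPart n = ν₂-aux-oddPart n n ≤-refl

k≤ν₂⇒2^k∣ : ∀ {k n} .{{_ : NonZero n}} → k ≤ ν₂ n → 2 ^ k ∣ n
k≤ν₂⇒2^k∣ {k} {n} k≤ν₂n with ν₂-oddPart n
... | o , _ , n≡ = subst (2 ^ k ∣_) (sym n≡) (∣-trans (^-monoʳ-∣ 2 k≤ν₂n) (m∣m*n o))

2^k∣⇒k≤ν₂ : ∀ {k n} .{{_ : NonZero n}} → 2 ^ k ∣ n → k ≤ ν₂ n
2^k∣⇒k≤ν₂ {k} {n} 2^k∣n with ν₂-oddPart n
... | o , 2∤o , n≡ = ≮⇒≥ λ ν₂n<k →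
  2^[1+k]∤2^k*odd (ν₂ n) 2∤o (subst (2 ^ suc (ν₂ n) ∣_) n≡ (∣-trans (^-monoʳ-∣ 2 ν₂n<k) 2^k∣n))

ν₂-unique : ∀ {n k o} .{{_ : NonZero n}} → ¬ 2 ∣ o → n ≡ 2 ^ k * o → ν₂ n ≡ k
ν₂-unique {n} {k} {o} 2∤o n≡ = ≤-antisym
  (≮⇒≥ λ k<ν₂n → 2^[1+k]∤2^k*odd k 2∤o (subst (2 ^ suc k ∣_) n≡ (k≤ν₂⇒2^k∣ k<ν₂n)))
  (2^k∣⇒k≤ν₂ (subst (2 ^ k ∣_) (sym n≡) (m∣m*n o)))

ν₂-* : ∀ m n .{{_ : NonZero m}} .{{_ : NonZero n}} → ν₂ (m * n) ≡ ν₂ m + ν₂ n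
ν₂-* m n with ν₂-oddPart m | ν₂-oddPart n
... | o , 2∤o , m≡ | o′ , 2∤o′ , n≡ = ν₂-unique {{m*n≢0 m n}} 2∤oo′ (begin
  m * n                                ≡⟨ cong₂ _*_ m≡ n≡ ⟩
  (2 ^ ν₂ m * o) * (2 ^ ν₂ n * o′)     ≡⟨ [m*n]*[o*p]≡[m*o]*[n*p] (2 ^ ν₂ m) o _ o′ ⟩
  (2 ^ ν₂ m * 2 ^ ν₂ n) * (o * o′)     ≡⟨ cong (_* (o * o′)) (^-distribˡ-+-* 2 (ν₂ m) (ν₂ n)) ⟨
  2 ^ (ν₂ m + ν₂ n) * (o * o′)         ∎)
  where
  open ≡-Reasoning
  2∤oo′ : ¬ 2 ∣ o * o′
  2∤oo′ 2∣oo′ with euclidsLemma o o′ prime[2] 2∣oo′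
  ... | inj₁ 2∣o  = 2∤o 2∣o
  ... | inj₂ 2∣o′ = 2∤o′ 2∣o′

gcd-nonZero : ∀ m n .{{_ : NonZero m}} → NonZero (gcd m n)
gcd-nonZero m n = ≢-nonZero (gcd[m,n]≢0 m n (inj₁ (≢-nonZero⁻¹ m)))

ν₂-gcd : ∀ m n .{{_ : NonZero m}} .{{_ : NonZero n}} → ν₂ (gcd m n) ≡ ν₂ m ⊓ ν₂ n
ν₂-gcd m n = ≤-antisym
  (⊓-glb (2^k∣⇒k≤ν₂ (∣-trans 2^ν₂g∣g (gcd[m,n]∣m m n)))
         (2^k∣⇒k≤ν₂ (∣-trans 2^ν₂g∣g (gcd[m,n]∣n m n))))
  (2^k∣⇒k≤ν₂
    (gcd-greatest (k≤ν₂⇒2^k∣ (m⊓n≤m (ν₂ m) (ν₂ n))) (k≤ν₂⇒2^k∣ (m⊓n≤n (ν₂ m) (ν₂ n)))))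
  where
  instance _ = gcd-nonZero m n
  2^ν₂g∣g : 2 ^ ν₂ (gcd m n) ∣ gcd m n
  2^ν₂g∣g = k≤ν₂⇒2^k∣ ≤-refl

2∣m⇔ν₂n<ν₂[m*n] : ∀ m n .{{_ : NonZero m}} .{{_ : NonZero n}} → 2 ∣ m ⇔ ν₂ n < ν₂ (m * n)
2∣m⇔ν₂n<ν₂[m*n] m n = subst (λ k → 2 ∣ m ⇔ ν₂ n < k) (sym (ν₂-* m n)) (mk⇔
  (λ 2∣m → m<n+m (ν₂ n) (2^k∣⇒k≤ν₂ 2∣m))
  (λ ν₂n<ν₂m+ν₂n → k≤ν₂⇒2^k∣ (+-cancelʳ-< (ν₂ n) 0 (ν₂ m) ν₂n<ν₂m+ν₂n)))

SignRel : Sign → Sign → ℕ → ℕ → Set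
SignRel ⊖ ⊕ x y = ⊤
SignRel ⊖ ⊖ x y = x < y
SignRel ⊕ ⊕ x y = y < x
SignRel ⊕ ⊖ x y = x ≡ y

SignCond⇔SignRel : ∀ ε₁ b₁ ms εₘ bₘ →
  SignCond (pat (ε₁ , b₁) ms (εₘ , bₘ)) ⇔ SignRel ε₁ εₘ (ν₂ b₁) (ν₂ bₘ)
SignCond⇔SignRel ε₁ b₁ _ εₘ bₘ = mk⇔ (to ε₁ εₘ) (from ε₁ εₘ)
  where
  x = ν₂ b₁
  y = ν₂ bₘ
  to : ∀ ε₁ εₘ → (x < y → ε₁ ≡ ⊖) × (y < x → εₘ ≡ ⊕) × (x ≡ y → ε₁ ≡ opposite εₘ) →
       SignRel ε₁ εₘ x y
  to ⊖ ⊕ _ = tt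
  to ⊖ ⊖ (_ , y<x⇒ , x≡y⇒) with <-cmp x y
  ... | tri< x<y _ _ = x<y
  ... | tri≈ _ x≡y _ = contradiction (x≡y⇒ x≡y) λ ()
  ... | tri> _ _ y<x = contradiction (y<x⇒ y<x) λ ()
  to ⊕ ⊕ (x<y⇒ , _ , x≡y⇒) with <-cmp x y
  ... | tri< x<y _ _ = contradiction (x<y⇒ x<y) λ ()
  ... | tri≈ _ x≡y _ = contradiction (x≡y⇒ x≡y) λ ()
  ... | tri> _ _ y<x = y<x
  to ⊕ ⊖ (x<y⇒ , y<x⇒ , _) with <-cmp x y
  ... | tri< x<y _ _ = contradiction (x<y⇒ x<y) λ ()
  ... | tri≈ _ x≡y _ = x≡y
  ... | tri> _ _ y<x = contradiction (y<x⇒ y<x) λ ()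
  from : ∀ ε₁ εₘ → SignRel ε₁ εₘ x y →
         (x < y → ε₁ ≡ ⊖) × (y < x → εₘ ≡ ⊕) × (x ≡ y → ε₁ ≡ opposite εₘ)
  from ⊖ ⊕ _   = (λ _ → refl) , (λ _ → refl) , (λ _ → refl)
  from ⊖ ⊖ x<y = (λ _ → refl)
               , (λ y<x → contradiction x<y (<-asym y<x))
               , (λ x≡y → contradiction x≡y (<⇒≢ x<y))
  from ⊕ ⊕ y<x = (λ x<y → contradiction y<x (<-asym x<y))
               , (λ _ → refl)
               , (λ x≡y → contradiction (sym x≡y) (<⇒≢ y<x))
  from ⊕ ⊖ x≡y = (λ x<y → contradiction x≡y (<⇒≢ x<y))
               , (λ y<x → contradiction (sym x≡y) (<⇒≢ y<x))
               , (λ _ → refl)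

m⊓n<n⇔m<n : ∀ m n → m ⊓ n < n ⇔ m < n
m⊓n<n⇔m<n m n = mk⇔
  (λ m⊓n<n → ≰⇒> λ n≤m → <-irrefl (m≥n⇒m⊓n≡n n≤m) m⊓n<n)
  (λ m<n → ≤-<-trans (m⊓n≤m m n) m<n)

m⊓n<m⇔n<m : ∀ m n → m ⊓ n < m ⇔ n < m
m⊓n<m⇔n<m m n = subst (λ k → k < m ⇔ n < m) (⊓-comm n m) (m⊓n<n⇔m<n n m)

SignRel-chain : ∀ {εa εb εc α β γ} → SignRel εa εb α β → SignRel εb εc β γ →
  α ⊓ γ < β ⇔ SignRel εa εc α γ
SignRel-chain {⊖} {⊕} {⊕} {α} _ γ<β = mk⇔ (λ _ → tt) (λ _ → ≤-<-trans (m⊓n≤n α _) γ<β)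
SignRel-chain {⊖} {⊕} {⊖} {α} _ refl = m⊓n<n⇔m<n α _
SignRel-chain {⊖} {⊖} {⊕} {γ = γ} α<β _ = mk⇔ (λ _ → tt) (λ _ → ≤-<-trans (m⊓n≤m _ γ) α<β)
SignRel-chain {⊖} {⊖} {⊖} {γ = γ} α<β β<γ =
  mk⇔ (λ _ → <-trans α<β β<γ) (λ _ → ≤-<-trans (m⊓n≤m _ γ) α<β)
SignRel-chain {⊕} {⊕} {⊕} {α} β<α γ<β =
  mk⇔ (λ _ → <-trans γ<β β<α) (λ _ → ≤-<-trans (m⊓n≤n α _) γ<β)
SignRel-chain {⊕} {⊕} {⊖} {α} β<α refl = mk⇔
  (λ α⊓β<β → contradiction (m⊓n<n⇔m<n α _ .Equivalence.to α⊓β<β) (<-asym β<α))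
  (λ α≡β → contradiction (sym α≡β) (<⇒≢ β<α))
SignRel-chain {⊕} {⊖} {⊕} {γ = γ} refl _ = m⊓n<m⇔n<m _ γ
SignRel-chain {⊕} {⊖} {⊖} {γ = γ} refl α<γ = mk⇔
  (λ α⊓γ<α → contradiction (m⊓n<m⇔n<m _ γ .Equivalence.to α⊓γ<α) (<-asym α<γ))
  (λ α≡γ → contradiction α≡γ (<⇒≢ α<γ))

-- A two-entry pattern has I = 0 = 0 · g, and 0 is even.
Parity-pair⇒SignRel : ∀ ε₁ b₁ ε₂ b₂ → Parity (pat (ε₁ , b₁) [] (ε₂ , b₂)) →
  SignRel ε₁ ε₂ (ν₂ b₁) (ν₂ b₂)
Parity-pair⇒SignRel ε₁ b₁ ε₂ b₂ parity = SignCond⇔SignRel ε₁ b₁ [] ε₂ b₂ .Equivalence.to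
  (parity (+ 0) refl .Equivalence.to (divides 0 refl))

claim16 : (a b c : ℕ) → (εa εb εc : Sign) → 0 < a → 0 < b → 0 < c →
    BasicParityTest (pat (εa , a) ((εb , b) ∷ []) (εc , c)) →
    Divisibility (pat (εa , a) ((εb , b) ∷ []) (εc , c)) →
    Parity (pat (εa , a) ((εb , b) ∷ []) (εc , c))
claim16 a b c εa εb εc 0<a 0<b 0<c (parity-ab , parity-bc , _) _ q I≡q*g =
  ⇔-trans 2∣q⇔ν₂a⊓ν₂c<ν₂b (⇔-trans
    (SignRel-chain (Parity-pair⇒SignRel εa a εb b parity-ab) (Parity-pair⇒SignRel εb b εc c parity-bc))
    (⇔-sym (SignCond⇔SignRel εa a ((εb , b) ∷ []) εc c)))
  where
  instance
    _ = >-nonZero 0<a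
    _ = >-nonZero 0<c
    _ = gcd-nonZero a c
  b≡∣q∣*g : b ≡ ∣ q ∣ * gcd a c
  b≡∣q∣*g = begin
    b                       ≡⟨ abs-◃ εb b ⟨
    ∣ εb ◃ b ∣              ≡⟨ cong ∣_∣ (trans (sym (ℤ-+-identityʳ (εb ◃ b))) I≡q*g) ⟩
    ∣ q ℤ.* + gcd a c ∣     ≡⟨ abs-* q (+ gcd a c) ⟩
    ∣ q ∣ * gcd a c         ∎
    where open ≡-Reasoning
  instance
    _ = m*n≢0⇒m≢0 ∣ q ∣ {{subst NonZero b≡∣q∣*g (>-nonZero 0<b)}}
  2∣q⇔ν₂a⊓ν₂c<ν₂b : 2 ∣ ∣ q ∣ ⇔ ν₂ a ⊓ ν₂ c < ν₂ b
  2∣q⇔ν₂a⊓ν₂c<ν₂b = subst₂ (λ x y → 2 ∣ ∣ q ∣ ⇔ x < y) (ν₂-gcd a c) (cong ν₂ (sym b≡∣q∣*g))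
    (2∣m⇔ν₂n<ν₂[m*n] ∣ q ∣ (gcd a c))
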